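{- Let $\mathcal{F}$ be the free non-symmetric operad on two binary generators $\alpha,\beta$, and let $\pi:\mathcal{F}\to\mathrm{CNCB}$ be the operad morphism with $\pi(\alpha)=\tau_{aaa}$ and $\pi(\beta)=\tau_{aba}$. Then $\pi$ induces an isomorphism from $\mathcal{F}/_{\equiv}$ onto the suboperad $\langle\tau_{aaa},\tau_{aba}\rangle$, where $\equiv$ is the smallest operad congruence of $\mathcal{F}$ containing $\beta\circ_1\beta\equiv\beta\circ_2\beta$ and $\alpha\circ_1\beta\equiv\alpha\circ_2\beta$.
   Context: A bicoloured noncrossing configuration (BNC) of size $n\ge2$ is a regular polygon with vertices $1,\dots,n+1$ (clockwise) with each arc $(i,j)$, $1\le i<j\le n+1$, coloured blue, red or uncoloured, such that no two coloured (blue or red) arcs cross and red arcs are diagonals. The edges are $(i,i+1)$ for $i\in[n]$ (the $i$-th edge), the base is $(1,n+1)$, and the other arcs are diagonals. There is also a unique BNC of size $1$, a single blue arc (its edge and base). $\mathrm{CNCB}$ is the non-symmetric operad of BNCs (arity = size, unit = the size-$1$ BNC) with composition $\mathfrak{C}\circ_i\mathfrak{D}$ ($\mathfrak{C}$ of size $n$, $\mathfrak{D}$ of size $m$) obtained by gluing the base of $\mathfrak{D}$ onto the $i$-th edge of $\mathfrak{C}$. Vertex $j$ of $\mathfrak{C}$ goes to $j$ if $j\le i$ and to $j+m-1$ otherwise, and vertex $\ell$ of $\mathfrak{D}$ goes to $i+\ell-1$. All other arcs keep their colours. The arc $(i,i+m)$ is red if the $i$-th edge of $\mathfrak{C}$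 and the base of $\mathfrak{D}$ are both uncoloured, blue if both are blue, and uncoloured otherwise. All remaining arcs are uncoloured. For $x,y,z\in\{a,b\}$, $\tau_{xyz}$ is the BNC of size $2$ (a triangle, which has no diagonals) whose first edge $(1,2)$, base $(1,3)$ and second edge $(2,3)$ are respectively coloured $x,y,z$, where $a$ means blue and $b$ means uncoloured. $\langle G\rangle$ denotes the smallest suboperad of $\mathrm{CNCB}$ containing $G$. -}

module Defs where

open import Data.Nat using (ℕ; zero; suc; _+_; _∸_; _≤_; _<_; _≡ᵇ_; _≤ᵇ_; _<ᵇ_)
open import Data.Bool using (Bool; true; false; if_then_else_; _∧_; _∨_)
open import Data.Product using (Σ; _×_; _,_; ∃)
open import Relation.Binary.PropositionalEquality using (_≡_)
open import Data.Sum using (_⊎_)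
open import Data.Empty using (⊥)
open import Data.Unit using (⊤)
open import Relation.Nullary using (¬_)
open import Function.Bundles using (_⇔_)

data Colour : Set where
  blue red none : Colour

-- A (raw) configuration of size n: the polygon has vertices 1 .. n+1,
-- and  col i j  is the colour of the arc (i,j) for 1 ≤ i < j ≤ n+1.
-- Values of col outside that range are irrelevant (see _≈_).
record Config : Set where
  constructor config
  field
    size : ℕ
    col  : ℕ → ℕ → Colour
open Config public

IsArc : ℕ → ℕ → ℕ → Set
IsArc n i j = 1 ≤ i × i < j × j ≤ suc n

_≈_ : Config → Config → Set
C ≈ D = (size C ≡ size D) × (∀ i j → IsArc (size C) i j → col C i j ≡ col D i j)

IsColoured : Colour → Set
IsColoured none = ⊥
IsColoured _    = ⊤

Cross : ℕ → ℕ → ℕ → ℕ → Set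
Cross i j k l = (i < k × k < j × j < l) ⊎ (k < i × i < l × l < j)

IsBNC : Config → Set
IsBNC C =
  (1 ≤ size C)
  × (size C ≡ 1 → col C 1 2 ≡ blue)
  × (∀ i j k l → IsArc (size C) i j → IsArc (size C) k l →
       IsColoured (col C i j) → IsColoured (col C k l) → ¬ Cross i j k l)
  × (∀ i j → IsArc (size C) i j → col C i j ≡ red →
       ¬ (j ≡ suc i) × ¬ (i ≡ 1 × j ≡ suc (size C)))

unitC : Config
unitC = config 1 (λ _ _ → blue)

-- Colour of the glued arc (i, i+m) from the i-th edge of C (x)
-- and the base of D (y).
glue : Colour → Colour → Colour
glue none none = red
glue blue blue = blue
glue _    _    = none

-- Partial composition  C ∘⟨ i ⟩ D  (1 ≤ i ≤ size C), gluing the base of D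
-- onto the i-th edge of C.
_∘⟨_⟩_ : Config → ℕ → Config → Config
C ∘⟨ i ⟩ D = config (size C + size D ∸ 1) c
  where
    m : ℕ
    m = size D
    inC : ℕ → Bool
    inC v = (v ≤ᵇ i) ∨ ((i + m) ≤ᵇ v)
    back : ℕ → ℕ
    back v = if v ≤ᵇ i then v else v ∸ (m ∸ 1)
    c : ℕ → ℕ → Colour
    c p q =
      if (p ≡ᵇ i) ∧ (q ≡ᵇ (i + m)) then glue (col C i (suc i)) (col D 1 (suc m))
      else if (i ≤ᵇ p) ∧ (q ≤ᵇ (i + m)) then col D (suc (p ∸ i)) (suc (q ∸ i))
      else if inC p ∧ inC q then col C (back p) (back q)
      else none

-- The triangles τ_xyz: first edge (1,2) x, base (1,3) y, second edge (2,3) z.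
τ : Colour → Colour → Colour → Config
τ x y z = config 2 c
  where
    c : ℕ → ℕ → Colour
    c 1 2 = x
    c 1 3 = y
    c 2 3 = z
    c _ _ = none

τaaa τaba : Config
τaaa = τ blue blue blue
τaba = τ blue none blue

data Gen⟨⟩ : Config → Set where
  g-unit : Gen⟨⟩ unitC
  g-aaa  : Gen⟨⟩ τaaa
  g-aba  : Gen⟨⟩ τaba
  g-comp : ∀ {C D} i → 1 ≤ i → i ≤ size C →
           Gen⟨⟩ C → Gen⟨⟩ D → Gen⟨⟩ (C ∘⟨ i ⟩ D)

_∈⟨τaaa,τaba⟩ : Config → Set
C ∈⟨τaaa,τaba⟩ = Σ Config (λ D → Gen⟨⟩ D × C ≈ D)

data G : Set where
  α β : G

data Tree : Set where
  leaf : Tree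
  node : G → Tree → Tree → Tree

arity : Tree → ℕ
arity leaf         = 1
arity (node _ l r) = arity l + arity r

-- grafting at the (k+1)-th leaf (0-based k)
graft : Tree → ℕ → Tree → Tree
graft leaf zero    u = u
graft leaf (suc k) u = leaf
graft (node g l r) k u =
  if k <ᵇ arity l then node g (graft l k u) r
  else node g l (graft r (k ∸ arity l) u)

_∘[_]_ : Tree → ℕ → Tree → Tree
s ∘[ i ] u = graft s (i ∸ 1) u

gen : G → Tree
gen g = node g leaf leaf

data _≡F_ : Tree → Tree → Set where
  rel-ββ : (gen β ∘[ 1 ] gen β) ≡F (gen β ∘[ 2 ] gen β)
  rel-αβ : (gen α ∘[ 1 ] gen β) ≡F (gen α ∘[ 2 ] gen β)
  ≡F-refl  : ∀ {s} → s ≡F s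
  ≡F-sym   : ∀ {s t} → s ≡F t → t ≡F s
  ≡F-trans : ∀ {s t u} → s ≡F t → t ≡F u → s ≡F u
  ≡F-congˡ : ∀ {s t} u i → 1 ≤ i → i ≤ arity s → s ≡F t →
             (s ∘[ i ] u) ≡F (t ∘[ i ] u)
  ≡F-congʳ : ∀ {s t} u i → 1 ≤ i → i ≤ arity u → s ≡F t →
             (u ∘[ i ] s) ≡F (u ∘[ i ] t)

-- The operad morphism π : F → CNCB, π(α) = τaaa, π(β) = τaba.
-- (node g l r = (g ∘₂ r) ∘₁ l in F.)

πG : G → Config
πG α = τaaa
πG β = τaba

π : Tree → Config
π leaf         = unitC
π (node g l r) = (πG g ∘⟨ 2 ⟩ π r) ∘⟨ 1 ⟩ π l

-- Under π, a tree t goes to the configuration ⟦ t ⟧ whose blue arcs are the edges of the polygon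
-- and the spans of the α-nodes of t, every other arc being uncoloured (no red arc ever appears,
-- since all edges are blue). This follows from a formula for the blue arcs of a grafted tree that
-- mirrors _∘⟨_⟩_, and it shows at once that the image of π is the suboperad generated by τaaa
-- and τaba. Both defining relations only move a β-node out of a left child, which changes no
-- span, so ≡F lies in the kernel of π. Conversely, every tree is ≡F-equivalent to one in which no
-- left child is a β-node, and such a tree is determined by its blue arcs: the colour of the base
-- gives the root label, and the longest blue arc from the first vertex other than the base is
-- the span of the left subtree.

module Submission where

open import Defs
open import Data.Bool using (Bool; true; false; T; if_then_else_; _∧_; _∨_)
open import Data.Bool.Properties using (∧-distribˡ-∨; ∧-identityʳ; ∨-assoc; ∨-identityʳ; if-cong; T-∧; T-∨)
open import Data.Empty using (⊥)
open import Data.Nat using (ℕ; zero; suc; _+_; _∸_; _≤_; _<_; _≤ᵇ_; z≤n; s≤s; _≤?_; _<?_; _≟_)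
open import Data.Nat.Properties
open import Algebra.Properties.CommutativeSemigroup +-commutativeSemigroup using (xy∙z≈xz∙y)
open import Data.Product using (Σ; _×_; _,_; proj₁; proj₂)
open import Data.Sum using (_⊎_; inj₁; inj₂)
open import Function.Base using (_∘_)
open import Function.Bundles using (_⇔_; mk⇔; Equivalence)
open import Relation.Binary.PropositionalEquality
open import Relation.Nullary using (¬_; Dec; yes; no; does; contradiction)
open import Relation.Nullary.Decidable using (dec-true; dec-false; does-⇔; _×-dec_; _⊎-dec_)


¬T⇒≡false : ∀ {b} → ¬ T b → b ≡ false
¬T⇒≡false {false} _ = refl
¬T⇒≡false {true}  h = contradiction _ h

T-∧⁻ : ∀ {x y} → T (x ∧ y) → T x × T y
T-∧⁻ = Equivalence.to T-∧

T-∨⁻ : ∀ {x y} → T (x ∨ y) → T x ⊎ T y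
T-∨⁻ = Equivalence.to T-∨

guarded-≡ : ∀ {P : Set} (P? : Dec P) {x y} → (T x → P) → (P → x ≡ y) → x ≡ does P? ∧ y
guarded-≡ (yes p) _     x≡y = x≡y p
guarded-≡ (no ¬p) x⇒p _   = ¬T⇒≡false (¬p ∘ x⇒p)

factor-∧ˡ : ∀ c {x y z x' y' z'} → x ≡ c ∧ x' → y ≡ c ∧ y' → z ≡ c ∧ z' →
            (x ∨ y ∨ z) ≡ c ∧ (x' ∨ y' ∨ z')
factor-∧ˡ c {x' = x'} {y'} {z'} refl refl refl =
  sym (trans (∧-distribˡ-∨ c x' (y' ∨ z')) (cong ((c ∧ x') ∨_) (∧-distribˡ-∨ c y' z')))

≟-+ʳ : ∀ m n k → does (m + k ≟ n + k) ≡ does (m ≟ n)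
≟-+ʳ m n k = does-⇔ (mk⇔ (+-cancelʳ-≡ k m n) (cong (_+ k))) (m + k ≟ n + k) (m ≟ n)

∸-<-cancelˡ : ∀ {n k m} → n ≤ k → k < n + m → k ∸ n < m
∸-<-cancelˡ {n} {k} {m} n≤k k<n+m = +-cancelˡ-< n _ _ (subst (_< n + m) (sym (m+[n∸m]≡n n≤k)) k<n+m)

+-∸-offset : ∀ o {n k} → n ≤ k → o + n + (k ∸ n) ≡ o + k
+-∸-offset o {n} {k} n≤k = trans (+-assoc o n (k ∸ n)) (cong (o +_) (m+[n∸m]≡n n≤k))

o+k+1+e≤o+[n+e] : ∀ o {k n} e → k < n → o + k + suc e ≤ o + (n + e)
o+k+1+e≤o+[n+e] o {k} {n} e k<n =
  subst (_≤ o + (n + e)) (trans (cong (o +_) (sym (+-suc k e))) (sym (+-assoc o k (suc e))))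
        (+-monoʳ-≤ o (+-monoˡ-≤ e k<n))


-- Blue arcs of a tree

arity-pos : ∀ t → 0 < arity t
arity-pos leaf         = s≤s z≤n
arity-pos (node _ l r) = ≤-trans (arity-pos l) (m≤m+n (arity l) (arity r))

isα : G → Bool
isα α = true
isα β = false

arcIf : Bool → ℕ → ℕ → ℕ → ℕ → Bool
arcIf b o e p q = b ∧ does (p ≟ o) ∧ does (q ≟ e)

-- blueArc t o p q: is (p, q) a blue arc of π t, once the leaves of t
-- are placed on the edges between the vertices o, o + 1, …, o + arity t?
blueArc : Tree → ℕ → ℕ → ℕ → Bool
blueArc leaf         o p q = arcIf true o (suc o) p q
blueArc (node g l r) o p q =
  arcIf (isα g) o (o + arity (node g l r)) p q ∨ blueArc l o p q ∨ blueArc r (o + arity l) p q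

Within : ℕ → ℕ → ℕ → ℕ → Set
Within o n p q = o ≤ p × p < q × q ≤ o + n

arcIf⇒endpoints : ∀ b {o e p q} → T (arcIf b o e p q) → p ≡ o × q ≡ e
arcIf⇒endpoints b {o} {e} {p} {q} h with _ , endpoints ← T-∧⁻ {b} h =
  ≡ᵇ⇒≡ p o (proj₁ (T-∧⁻ endpoints)) , ≡ᵇ⇒≡ q e (proj₂ (T-∧⁻ {does (p ≟ o)} endpoints))

arcIf-false : ∀ b o e {p q} → (p ≡ o → q ≡ e → ⊥) → arcIf b o e p q ≡ false
arcIf-false b o e h = ¬T⇒≡false (λ t → let (p≡o , q≡e) = arcIf⇒endpoints b t in h p≡o q≡e)

arcIf-at : ∀ b o e → arcIf b o e o e ≡ b
arcIf-at b o e =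
  trans (cong₂ (λ x y → b ∧ x ∧ y) (dec-true (o ≟ o) refl) (dec-true (e ≟ e) refl)) (∧-identityʳ b)

blueArc-within : ∀ t o {p q} → T (blueArc t o p q) → Within o (arity t) p q
blueArc-within leaf o {p} {q} h with refl , refl ← arcIf⇒endpoints true {o} {suc o} {p} {q} h
  = ≤-refl , ≤-refl , ≤-reflexive (+-comm 1 p)
blueArc-within (node g l r) o {p} {q} h
  with T-∨⁻ {arcIf (isα g) o (o + arity (node g l r)) p q} h
... | inj₁ root with refl , refl ← arcIf⇒endpoints (isα g) {o} {o + arity (node g l r)} {p} {q} root
  = ≤-refl , m<m+n p (arity-pos (node g l r)) , ≤-refl
... | inj₂ sub with T-∨⁻ {blueArc l o p q} sub
...   | inj₁ inL = let (op , pq , ql) = blueArc-within l o inL in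
                   op , pq , ≤-trans ql (+-monoʳ-≤ o (m≤m+n (arity l) (arity r)))
...   | inj₂ inR = let (lp , pq , qr) = blueArc-within r (o + arity l) inR in
                   ≤-trans (m≤m+n o (arity l)) lp , pq ,
                   ≤-trans qr (≤-reflexive (+-assoc o (arity l) (arity r)))

blueArc-outside : ∀ t o {p q} → ¬ Within o (arity t) p q → blueArc t o p q ≡ false
blueArc-outside t o out = ¬T⇒≡false (out ∘ blueArc-within t o)

blueArc-before : ∀ t {o p} q → p < o → blueArc t o p q ≡ false
blueArc-before t q p<o = blueArc-outside t _ λ (o≤p , _) → <⇒≱ p<o o≤p

blueArc-reversed : ∀ t o {p q} → q ≤ p → blueArc t o p q ≡ false
blueArc-reversed t o q≤p = blueArc-outside t o λ (_ , p<q , _) → <⇒≱ p<q q≤p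

blueArc-after : ∀ t {o} p {q} → o + arity t < q → blueArc t o p q ≡ false
blueArc-after t p end<q = blueArc-outside t _ λ (_ , _ , q≤end) → <⇒≱ end<q q≤end

blueArc-from-end : ∀ t {o p} q → o + arity t ≤ p → blueArc t o p q ≡ false
blueArc-from-end t q end≤p = blueArc-outside t _ λ (_ , p<q , q≤end) → <⇒≱ (<-≤-trans p<q q≤end) end≤p

arcIf-shift : ∀ b o e k p q → arcIf b (o + k) (e + k) (p + k) (q + k) ≡ arcIf b o e p q
arcIf-shift b o e k p q = cong (b ∧_) (cong₂ _∧_ (≟-+ʳ p o k) (≟-+ʳ q e k))

blueArc-shift : ∀ t o k p q → blueArc t (o + k) (p + k) (q + k) ≡ blueArc t o p q
blueArc-shift leaf o k p q = arcIf-shift true o (suc o) k p q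
blueArc-shift (node g l r) o k p q = cong₂ _∨_
  (trans (cong (λ e → arcIf (isα g) (o + k) e (p + k) (q + k)) (xy∙z≈xz∙y o k (arity l + arity r)))
         (arcIf-shift (isα g) o (o + (arity l + arity r)) k p q))
  (cong₂ _∨_ (blueArc-shift l o k p q)
    (trans (cong (λ x → blueArc r x (p + k) (q + k)) (xy∙z≈xz∙y o k (arity l)))
           (blueArc-shift r (o + arity l) k p q)))

module _ (g : G) (l r : Tree) (o : ℕ) where

  private
    mid end : ℕ
    mid = o + arity l
    end = o + arity (node g l r)

    o<mid : o < mid
    o<mid = m<m+n o (arity-pos l)

    mid<end : mid < end
    mid<end = subst (mid <_) (+-assoc o (arity l) (arity r)) (m<m+n mid (arity-pos r))

  blueArc-node-left : ∀ {p q} → q ≤ mid → blueArc (node g l r) o p q ≡ blueArc l o p q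
  blueArc-node-left {p} {q} q≤mid = begin
    arcIf (isα g) o end p q ∨ blueArc l o p q ∨ blueArc r mid p q
      ≡⟨ cong₂ (λ x y → x ∨ blueArc l o p q ∨ y)
           (arcIf-false (isα g) o end {p} {q} λ _ q≡end → <⇒≢ (≤-<-trans q≤mid mid<end) q≡end)
           (blueArc-outside r mid {p} {q} λ (mid≤p , p<q , _) → <⇒≱ p<q (≤-trans q≤mid mid≤p)) ⟩
    blueArc l o p q ∨ false
      ≡⟨ ∨-identityʳ _ ⟩
    blueArc l o p q ∎
    where open ≡-Reasoning

  blueArc-node-right : ∀ {p q} → mid ≤ p → blueArc (node g l r) o p q ≡ blueArc r mid p q
  blueArc-node-right {p} {q} mid≤p = cong₂ _∨_
    (arcIf-false (isα g) o end {p} {q} λ p≡o _ → <⇒≱ o<mid (≤-trans mid≤p (≤-reflexive p≡o)))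
    (cong (_∨ blueArc r mid p q) (blueArc-from-end l q mid≤p))

  blueArc-node-span : blueArc (node g l r) o o end ≡ isα g
  blueArc-node-span = begin
    arcIf (isα g) o end o end ∨ blueArc l o o end ∨ blueArc r mid o end
      ≡⟨ cong₂ _∨_
           (arcIf-at (isα g) o end)
           (cong₂ _∨_ (blueArc-after l o mid<end) (blueArc-before r end o<mid)) ⟩
    isα g ∨ false
      ≡⟨ ∨-identityʳ _ ⟩
    isα g ∎
    where open ≡-Reasoning

blueArc-edge : ∀ t o {p} → o ≤ p → p < o + arity t → T (blueArc t o p (suc p))
blueArc-edge leaf o {p} o≤p p<o+1 with refl ← ≤-antisym o≤p (≤-pred (subst (p <_) (+-comm o 1) p<o+1))
  = subst T (sym (arcIf-at true p (suc p))) _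
blueArc-edge (node g l r) o {p} o≤p p<end with p <? o + arity l
... | yes p<mid = subst T (sym (blueArc-node-left g l r o p<mid)) (blueArc-edge l o o≤p p<mid)
... | no  p≮mid = subst T (sym (blueArc-node-right g l r o (≮⇒≥ p≮mid)))
  (blueArc-edge r (o + arity l) (≮⇒≥ p≮mid) (subst (p <_) (sym (+-assoc o (arity l) (arity r))) p<end))


-- Blue arcs of a grafted tree

graft-node-< : ∀ g l r u {k} → k < arity l → graft (node g l r) k u ≡ node g (graft l k u) r
graft-node-< g l r u {k} k<l = if-cong (dec-true (k <? arity l) k<l)

graft-node-≥ : ∀ g l r u {k} → arity l ≤ k → graft (node g l r) k u ≡ node g l (graft r (k ∸ arity l) u)
graft-node-≥ g l r u {k} l≤k = if-cong (dec-false (k <? arity l) (≤⇒≯ l≤k))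

arity-graft : ∀ s k u {e} → arity u ≡ suc e → k < arity s → arity (graft s k u) ≡ arity s + e
arity-graft leaf zero u arity-u _ = arity-u
arity-graft leaf (suc k) u _ (s≤s ())
arity-graft (node g l r) k u {e} arity-u k<n with k <? arity l
... | yes k<l = begin
  arity (graft (node g l r) k u) ≡⟨ cong arity (graft-node-< g l r u k<l) ⟩
  arity (graft l k u) + arity r ≡⟨ cong (_+ arity r) (arity-graft l k u arity-u k<l) ⟩
  arity l + e + arity r         ≡⟨ xy∙z≈xz∙y (arity l) e (arity r) ⟩
  arity l + arity r + e         ∎
  where open ≡-Reasoning
... | no k≮l = begin
  arity (graft (node g l r) k u)            ≡⟨ cong arity (graft-node-≥ g l r u (≮⇒≥ k≮l)) ⟩
  arity l + arity (graft r (k ∸ arity l) u) ≡⟨ cong (arity l +_) (arity-graft r (k ∸ arity l) u arity-u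
                                                                (∸-<-cancelˡ (≮⇒≥ k≮l) k<n)) ⟩
  arity l + (arity r + e)                   ≡⟨ +-assoc (arity l) (arity r) e ⟨
  arity l + arity r + e                     ∎
  where open ≡-Reasoning

-- Inner, outer? and unshift are the tests and the renumbering of vertices used by _∘⟨_⟩_,
-- when a configuration with m edges is glued onto the edge (a, a + 1).
Inner : ℕ → ℕ → ℕ → ℕ → Set
Inner a m p q = a ≤ p × q ≤ a + m

inner? : ∀ a m p q → Dec (Inner a m p q)
inner? a m p q = a ≤? p ×-dec q ≤? a + m

Outer : ℕ → ℕ → ℕ → Set
Outer a m v = v ≤ a ⊎ a + m ≤ v

outer? : ∀ a m v → Dec (Outer a m v)
outer? a m v = v ≤? a ⊎-dec a + m ≤? v

unshift : ℕ → ℕ → ℕ → ℕ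
unshift a m v = if v ≤ᵇ a then v else v ∸ (m ∸ 1)

graftedBlue : (ℕ → ℕ → Bool) → (ℕ → ℕ → Bool) → ℕ → ℕ → ℕ → ℕ → Bool
graftedBlue bs bu a m p q =
  if does (inner? a m p q) then bu p q
  else does (outer? a m p ×-dec outer? a m q) ∧ bs (unshift a m p) (unshift a m q)

module Unshift (a e : ℕ) where

  data OuterView : ℕ → Set where
    left  : ∀ {v} → v ≤ a → OuterView v
    right : ∀ {w} → a < w → OuterView (w + e)

  outerView : ∀ {v} → Outer a (suc e) v → OuterView v
  outerView (inj₁ v≤a)         = left v≤a
  outerView {v} (inj₂ a+m≤v) = subst OuterView (m∸n+n≡m e≤v) (right a<v∸e)
    where
    a+1+e≤v : suc a + e ≤ v
    a+1+e≤v = subst (_≤ v) (+-suc a e) a+m≤v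
    e≤v : e ≤ v
    e≤v = ≤-trans (m≤n+m e (suc a)) a+1+e≤v
    a<v∸e : a < v ∸ e
    a<v∸e = subst (_≤ v ∸ e) (m+n∸n≡m (suc a) e) (∸-monoˡ-≤ e a+1+e≤v)

  outer-right : ∀ {w} → a < w → Outer a (suc e) (w + e)
  outer-right {w} a<w = inj₂ (subst (_≤ w + e) (sym (+-suc a e)) (+-monoˡ-≤ e a<w))

  unshift-left : ∀ {v} → v ≤ a → unshift a (suc e) v ≡ v
  unshift-left {v} v≤a = if-cong (dec-true (v ≤? a) v≤a)

  unshift-right : ∀ {w} → a < w → unshift a (suc e) (w + e) ≡ w
  unshift-right {w} a<w =
    trans (if-cong (dec-false (w + e ≤? a) (<⇒≱ (<-≤-trans a<w (m≤m+n w e))))) (m+n∸n≡m w e)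

  unshift-injective : ∀ {v v'} → Outer a (suc e) v → Outer a (suc e) v' →
                      unshift a (suc e) v ≡ unshift a (suc e) v' → v ≡ v'
  unshift-injective ov ov' eq with outerView ov | outerView ov'
  ... | left v≤a  | left v'≤a  = trans (sym (unshift-left v≤a)) (trans eq (unshift-left v'≤a))
  ... | left v≤a  | right a<w' =
    contradiction (trans (sym (unshift-left v≤a)) (trans eq (unshift-right a<w'))) (<⇒≢ (≤-<-trans v≤a a<w'))
  ... | right a<w | left v'≤a  =
    contradiction (trans (sym (unshift-left v'≤a)) (trans (sym eq) (unshift-right a<w))) (<⇒≢ (≤-<-trans v'≤a a<w))
  ... | right a<w | right a<w' =
    cong (_+ e) (trans (sym (unshift-right a<w)) (trans eq (unshift-right a<w')))

  arcIf-unshift : ∀ b {o x v w} → Outer a (suc e) o → Outer a (suc e) x → Outer a (suc e) v → Outer a (suc e) w →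
    arcIf b (unshift a (suc e) o) (unshift a (suc e) x) (unshift a (suc e) v) (unshift a (suc e) w) ≡ arcIf b o x v w
  arcIf-unshift b oo ox ov ow = cong (b ∧_) (cong₂ _∧_ (same ov oo) (same ow ox))
    where
    same : ∀ {v o} → Outer a (suc e) v → Outer a (suc e) o →
           does (unshift a (suc e) v ≟ unshift a (suc e) o) ≡ does (v ≟ o)
    same {v} {o} ov oo = does-⇔ (mk⇔ (unshift-injective ov oo) (cong (unshift a (suc e))))
                          (unshift a (suc e) v ≟ unshift a (suc e) o) (v ≟ o)

  unshift-arc : ∀ {n p q} → a ≤ n → IsArc (n + e) p q → Outer a (suc e) p → Outer a (suc e) q →
                IsArc n (unshift a (suc e) p) (unshift a (suc e) q)
  unshift-arc {n} a≤n (1≤p , p<q , q≤) op oq with outerView op | outerView oq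
  ... | left p≤a  | left q≤a   = subst₂ (IsArc n) (sym (unshift-left p≤a)) (sym (unshift-left q≤a))
                                   (1≤p , p<q , m≤n⇒m≤1+n (≤-trans q≤a a≤n))
  ... | left p≤a  | right a<w' = subst₂ (IsArc n) (sym (unshift-left p≤a)) (sym (unshift-right a<w'))
                                   (1≤p , ≤-<-trans p≤a a<w' , +-cancelʳ-≤ e _ _ q≤)
  ... | right a<w | left q≤a   = contradiction (≤-trans (m≤m+n _ e) (<⇒≤ p<q)) (<⇒≱ (≤-<-trans q≤a a<w))
  ... | right a<w | right a<w' = subst₂ (IsArc n) (sym (unshift-right a<w)) (sym (unshift-right a<w'))
                                   (≤-trans (s≤s z≤n) a<w , +-cancelʳ-< e _ _ p<q , +-cancelʳ-≤ e _ _ q≤)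

module GraftArcs (a e p q : ℕ) where

  open Unshift a e

  private
    OuterArc : Set
    OuterArc = Outer a (suc e) p × Outer a (suc e) q

    outerArc? : Dec OuterArc
    outerArc? = outer? a (suc e) p ×-dec outer? a (suc e) q

    c : Bool
    c = does outerArc?

    p' q' : ℕ
    p' = unshift a (suc e) p
    q' = unshift a (suc e) q

  root-term : ∀ b {o x} → o ≤ a → a < x → arcIf b o (x + e) p q ≡ c ∧ arcIf b o x p' q'
  root-term b {o} {x} o≤a a<x = guarded-≡ outerArc? endpointsOuter sameArc
    where
    endpointsOuter : T (arcIf b o (x + e) p q) → OuterArc
    endpointsOuter h = let (p≡o , q≡x+e) = arcIf⇒endpoints b h in
      inj₁ (subst (_≤ a) (sym p≡o) o≤a) , subst (Outer a (suc e)) (sym q≡x+e) (outer-right a<x)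
    sameArc : OuterArc → arcIf b o (x + e) p q ≡ arcIf b o x p' q'
    sameArc (op , oq) = sym (begin
      arcIf b o x p' q'
        ≡⟨ cong₂ (λ y z → arcIf b y z p' q') (unshift-left o≤a) (unshift-right a<x) ⟨
      arcIf b (unshift a (suc e) o) (unshift a (suc e) (x + e)) p' q'
        ≡⟨ arcIf-unshift b (inj₁ o≤a) (outer-right a<x) op oq ⟩
      arcIf b o (x + e) p q ∎)
      where open ≡-Reasoning

  right-term : ∀ t {x} → a < x → blueArc t (x + e) p q ≡ c ∧ blueArc t x p' q'
  right-term t {x} a<x = guarded-≡ outerArc? rightOfGraft sameArc
    where
    a+1+e≤x+e : a + suc e ≤ x + e
    a+1+e≤x+e = subst (_≤ x + e) (sym (+-suc a e)) (+-monoˡ-≤ e a<x)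
    rightOfGraft : T (blueArc t (x + e) p q) → OuterArc
    rightOfGraft h = let (x+e≤p , p<q , _) = blueArc-within t (x + e) h in
      inj₂ (≤-trans a+1+e≤x+e x+e≤p) , inj₂ (≤-trans a+1+e≤x+e (≤-trans x+e≤p (<⇒≤ p<q)))
    sameArc : OuterArc → blueArc t (x + e) p q ≡ blueArc t x p' q'
    sameArc (op , oq) with outerView op | outerView oq
    ... | left p≤a | _ =
      trans (blueArc-before t q (<-≤-trans p<x (m≤m+n x e)))
            (sym (trans (cong (λ v → blueArc t x v q') (unshift-left p≤a)) (blueArc-before t q' p<x)))
      where
      p<x : p < x
      p<x = ≤-<-trans p≤a a<x
    ... | right {w} a<w | left q≤a =
      trans (blueArc-reversed t (x + e) (≤-trans q≤w (m≤m+n w e)))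
            (sym (trans (cong₂ (blueArc t x) (unshift-right a<w) (unshift-left q≤a)) (blueArc-reversed t x q≤w)))
      where
      q≤w : q ≤ w
      q≤w = <⇒≤ (≤-<-trans q≤a a<w)
    ... | right a<w | right a<w' =
      trans (blueArc-shift t x e _ _) (sym (cong₂ (blueArc t x) (unshift-right a<w) (unshift-right a<w')))

  left-term : ∀ t {x} → x + arity t ≤ a → blueArc t x p q ≡ c ∧ blueArc t x p' q'
  left-term t {x} end≤a = guarded-≡ outerArc? leftOfGraft sameArc
    where
    leftOfGraft : T (blueArc t x p q) → OuterArc
    leftOfGraft h = let (_ , p<q , q≤end) = blueArc-within t x h in
      inj₁ (≤-trans (<⇒≤ p<q) (≤-trans q≤end end≤a)) , inj₁ (≤-trans q≤end end≤a)
    sameArc : OuterArc → blueArc t x p q ≡ blueArc t x p' q'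
    sameArc (op , oq) with outerView op | outerView oq
    ... | left p≤a  | left q≤a   = sym (cong₂ (blueArc t x) (unshift-left p≤a) (unshift-left q≤a))
    ... | left p≤a  | right {w'} a<w' =
      trans (blueArc-after t p (<-≤-trans end<w' (m≤m+n w' e)))
            (sym (trans (cong (blueArc t x p') (unshift-right a<w')) (blueArc-after t p' end<w')))
      where
      end<w' : x + arity t < w'
      end<w' = ≤-<-trans end≤a a<w'
    ... | right {w} a<w | _ =
      trans (blueArc-from-end t q (≤-trans end≤w (m≤m+n w e)))
            (sym (trans (cong (λ v → blueArc t x v q') (unshift-right a<w)) (blueArc-from-end t q' end≤w)))
      where
      end≤w : x + arity t ≤ w
      end≤w = <⇒≤ (≤-<-trans end≤a a<w)

  blueArc-graft-inner : ∀ s k u o → arity u ≡ suc e → k < arity s → o + k ≡ a → Inner a (suc e) p q →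
                        blueArc (graft s k u) o p q ≡ blueArc u a p q
  blueArc-graft-inner leaf zero u o _ _ o+0≡a _ =
    cong (λ x → blueArc u x p q) (trans (sym (+-identityʳ o)) o+0≡a)
  blueArc-graft-inner leaf (suc k) u o _ (s≤s ()) _ _
  blueArc-graft-inner (node g l r) k u o arity-u k<n o+k≡a inner@(a≤p , q≤a+m) with k <? arity l
  ... | yes k<l = begin
    blueArc (graft (node g l r) k u) o p q  ≡⟨ cong (λ t → blueArc t o p q) (graft-node-< g l r u k<l) ⟩
    blueArc (node g (graft l k u) r) o p q  ≡⟨ blueArc-node-left g (graft l k u) r o q≤mid ⟩
    blueArc (graft l k u) o p q             ≡⟨ blueArc-graft-inner l k u o arity-u k<l o+k≡a inner ⟩
    blueArc u a p q                         ∎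
    where
    open ≡-Reasoning
    q≤mid : q ≤ o + arity (graft l k u)
    q≤mid = ≤-trans q≤a+m (subst₂ (λ x y → x + suc e ≤ o + y) o+k≡a (sym (arity-graft l k u arity-u k<l))
                                  (o+k+1+e≤o+[n+e] o e k<l))
  ... | no k≮l = begin
    blueArc (graft (node g l r) k u) o p q  ≡⟨ cong (λ t → blueArc t o p q) (graft-node-≥ g l r u l≤k) ⟩
    blueArc (node g l (graft r k' u)) o p q ≡⟨ blueArc-node-right g l (graft r k' u) o mid≤p ⟩
    blueArc (graft r k' u) (o + arity l) p q
      ≡⟨ blueArc-graft-inner r k' u (o + arity l) arity-u (∸-<-cancelˡ l≤k k<n)
                             (trans (+-∸-offset o l≤k) o+k≡a) inner ⟩
    blueArc u a p q                         ∎
    where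
    open ≡-Reasoning
    l≤k : arity l ≤ k
    l≤k = ≮⇒≥ k≮l
    k' : ℕ
    k' = k ∸ arity l
    mid≤p : o + arity l ≤ p
    mid≤p = ≤-trans (+-monoʳ-≤ o l≤k) (subst (_≤ p) (sym o+k≡a) a≤p)

  outer-leaf : ∀ u → arity u ≡ suc e → ¬ Inner a (suc e) p q → blueArc u a p q ≡ c ∧ blueArc leaf a p' q'
  outer-leaf u arity-u ¬inner =
    guarded-≡ outerArc? (λ h → contradiction (insideGraft (blueArc-within u a h)) ¬inner) bothFalse
    where
    insideGraft : Within a (arity u) p q → Inner a (suc e) p q
    insideGraft (a≤p , _ , q≤) = a≤p , subst (λ n → q ≤ a + n) arity-u q≤
    bothFalse : OuterArc → blueArc u a p q ≡ arcIf true a (suc a) p' q'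
    bothFalse (op , oq) = trans (blueArc-outside u a (¬inner ∘ insideGraft)) (sym (begin
      arcIf true a (suc a) p' q'
        ≡⟨ cong₂ (λ y z → arcIf true y z p' q') (unshift-left ≤-refl) (unshift-right ≤-refl) ⟨
      arcIf true (unshift a (suc e) a) (unshift a (suc e) (suc a + e)) p' q'
        ≡⟨ arcIf-unshift true (inj₁ ≤-refl) (outer-right ≤-refl) op oq ⟩
      arcIf true a (suc a + e) p q
        ≡⟨ arcIf-false true a (suc a + e) (λ p≡a q≡end →
             ¬inner (≤-reflexive (sym p≡a) , ≤-reflexive (trans q≡end (sym (+-suc a e))))) ⟩
      false ∎))
      where open ≡-Reasoning

  outer-node-left : ∀ g l r {L} o → arity L ≡ arity l + e → o ≤ a → a < o + arity l →
                    blueArc L o p q ≡ c ∧ blueArc l o p' q' →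
                    blueArc (node g L r) o p q ≡ c ∧ blueArc (node g l r) o p' q'
  outer-node-left g l r {L} o arity-L o≤a a<mid L-arcs = begin
    arcIf (isα g) o (o + (arity L + arity r)) p q ∨ blueArc L o p q ∨ blueArc r (o + arity L) p q
      ≡⟨ cong₂ (λ x y → arcIf (isα g) o x p q ∨ blueArc L o p q ∨ blueArc r y p q) end≡ mid≡ ⟩
    arcIf (isα g) o (end + e) p q ∨ blueArc L o p q ∨ blueArc r (o + arity l + e) p q
      ≡⟨ factor-∧ˡ c (root-term (isα g) o≤a a<end) L-arcs (right-term r a<mid) ⟩
    c ∧ blueArc (node g l r) o p' q' ∎
    where
    open ≡-Reasoning
    end : ℕ
    end = o + (arity l + arity r)
    end≡ : o + (arity L + arity r) ≡ end + e
    end≡ = trans (cong (λ n → o + (n + arity r)) arity-L)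
                 (trans (cong (o +_) (xy∙z≈xz∙y (arity l) e (arity r))) (sym (+-assoc o _ e)))
    mid≡ : o + arity L ≡ o + arity l + e
    mid≡ = trans (cong (o +_) arity-L) (sym (+-assoc o (arity l) e))
    a<end : a < end
    a<end = <-≤-trans a<mid (+-monoʳ-≤ o (m≤m+n (arity l) (arity r)))

  outer-node-right : ∀ g l r {R} o → arity R ≡ arity r + e → o + arity l ≤ a → a < o + (arity l + arity r) →
                     blueArc R (o + arity l) p q ≡ c ∧ blueArc r (o + arity l) p' q' →
                     blueArc (node g l R) o p q ≡ c ∧ blueArc (node g l r) o p' q'
  outer-node-right g l r {R} o arity-R mid≤a a<end R-arcs = begin
    arcIf (isα g) o (o + (arity l + arity R)) p q ∨ blueArc l o p q ∨ blueArc R (o + arity l) p q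
      ≡⟨ cong (λ x → arcIf (isα g) o x p q ∨ blueArc l o p q ∨ blueArc R (o + arity l) p q) end≡ ⟩
    arcIf (isα g) o (o + (arity l + arity r) + e) p q ∨ blueArc l o p q ∨ blueArc R (o + arity l) p q
      ≡⟨ factor-∧ˡ c (root-term (isα g) (≤-trans (m≤m+n o (arity l)) mid≤a) a<end)
                     (left-term l mid≤a) R-arcs ⟩
    c ∧ blueArc (node g l r) o p' q' ∎
    where
    open ≡-Reasoning
    end≡ : o + (arity l + arity R) ≡ o + (arity l + arity r) + e
    end≡ = trans (cong (λ n → o + (arity l + n)) arity-R)
                 (trans (cong (o +_) (sym (+-assoc (arity l) (arity r) e))) (sym (+-assoc o _ e)))

  blueArc-graft-outer : ∀ s k u o → arity u ≡ suc e → k < arity s → o + k ≡ a → ¬ Inner a (suc e) p q →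
                        blueArc (graft s k u) o p q ≡ c ∧ blueArc s o p' q'
  blueArc-graft-outer leaf zero u o arity-u _ o+0≡a ¬inner
    with refl ← trans (sym (+-identityʳ o)) o+0≡a = outer-leaf u arity-u ¬inner
  blueArc-graft-outer leaf (suc k) u o _ (s≤s ()) _ _
  blueArc-graft-outer (node g l r) k u o arity-u k<n o+k≡a ¬inner with k <? arity l
  ... | yes k<l = trans (cong (λ t → blueArc t o p q) (graft-node-< g l r u k<l))
    (outer-node-left g l r {graft l k u} o (arity-graft l k u arity-u k<l)
      (subst (o ≤_) o+k≡a (m≤m+n o k)) (subst (_< o + arity l) o+k≡a (+-monoʳ-< o k<l))
      (blueArc-graft-outer l k u o arity-u k<l o+k≡a ¬inner))
  ... | no k≮l = trans (cong (λ t → blueArc t o p q) (graft-node-≥ g l r u l≤k))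
    (outer-node-right g l r {graft r (k ∸ arity l) u} o (arity-graft r (k ∸ arity l) u arity-u k'<r)
      (subst (o + arity l ≤_) o+k≡a (+-monoʳ-≤ o l≤k)) (subst (_< o + (arity l + arity r)) o+k≡a (+-monoʳ-< o k<n))
      (blueArc-graft-outer r (k ∸ arity l) u (o + arity l) arity-u k'<r (trans (+-∸-offset o l≤k) o+k≡a) ¬inner))
    where
    l≤k : arity l ≤ k
    l≤k = ≮⇒≥ k≮l
    k'<r : k ∸ arity l < arity r
    k'<r = ∸-<-cancelˡ l≤k k<n

blueArc-graft : ∀ s k u o → k < arity s → ∀ p q →
  blueArc (graft s k u) o p q ≡ graftedBlue (blueArc s o) (blueArc u (o + k)) (o + k) (arity u) p q
blueArc-graft s k u o k<n p q with arity u in arity-u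
... | zero  = contradiction (subst (0 <_) arity-u (arity-pos u)) λ ()
... | suc e with inner? (o + k) (suc e) p q
...   | yes inner = trans (blueArc-graft-inner s k u o arity-u k<n refl inner)
                          (sym (if-cong (dec-true (inner? (o + k) (suc e) p q) inner)))
  where open GraftArcs (o + k) e p q
...   | no ¬inner = trans (blueArc-graft-outer s k u o arity-u k<n refl ¬inner)
                          (sym (if-cong (dec-false (inner? (o + k) (suc e) p q) ¬inner)))
  where open GraftArcs (o + k) e p q

graftedBlue-cong : ∀ {bs bs' bu bu'} a m p q → (∀ x y → bs x y ≡ bs' x y) → (∀ x y → bu x y ≡ bu' x y) →
                   graftedBlue bs bu a m p q ≡ graftedBlue bs' bu' a m p q
graftedBlue-cong a m p q bs≗ bu≗ =
  cong₂ (λ x y → if does (inner? a m p q) then x else does (outer? a m p ×-dec outer? a m q) ∧ y)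
        (bu≗ p q) (bs≗ _ _)


-- Trees as configurations

blueIf : Bool → Colour
blueIf true  = blue
blueIf false = none

⟦_⟧ : Tree → Config
⟦ t ⟧ = config (arity t) (λ p q → blueIf (blueArc t 1 p q))

≈-sym : ∀ {C D} → C ≈ D → D ≈ C
≈-sym (refl , same) = refl , λ i j arc → sym (same i j arc)

≈-trans : ∀ {C D E} → C ≈ D → D ≈ E → C ≈ E
≈-trans (refl , same) (refl , same') = refl , λ i j arc → trans (same i j arc) (same' i j arc)

≈⟦⟧-col : ∀ {C} t {p q} → C ≈ ⟦ t ⟧ → IsArc (arity t) p q → col C p q ≡ blueIf (blueArc t 1 p q)
≈⟦⟧-col t {p} {q} (refl , same) arc = same p q arc

arity-suc : ∀ t → Σ ℕ (λ e → arity t ≡ suc e)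
arity-suc t with arity t | arity-pos t
... | suc e | _ = e , refl

composedColour : (ℕ → ℕ → Colour) → (ℕ → ℕ → Colour) → ℕ → ℕ → ℕ → ℕ → Colour
composedColour cC cD i m p q =
  if does (p ≟ i) ∧ does (q ≟ i + m) then glue (cC i (suc i)) (cD 1 (suc m))
  else if does (inner? i m p q) then cD (suc (p ∸ i)) (suc (q ∸ i))
  else if does (outer? i m p ×-dec outer? i m q) then cC (unshift i m p) (unshift i m q)
  else none

col-∘⟨⟩ : ∀ C i D p q → col (C ∘⟨ i ⟩ D) p q ≡ composedColour (col C) (col D) i (size D) p q
col-∘⟨⟩ _ _ _ _ _ = refl

glue-blue : ∀ b → glue blue (blueIf b) ≡ blueIf b
glue-blue true  = refl
glue-blue false = refl

if-does-∧ : ∀ {P : Set} (P? : Dec P) {c : Colour} {b} → (P → c ≡ blueIf b) →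
            (if does P? then c else none) ≡ blueIf (does P? ∧ b)
if-does-∧ (yes p) c≡ = c≡ p
if-does-∧ (no _)  _  = refl

T⇒blueIf : ∀ {b} → T b → blueIf b ≡ blue
T⇒blueIf {true} _ = refl

module _ {s u : Tree} {C D : Config} (C≈ : C ≈ ⟦ s ⟧) (D≈ : D ≈ ⟦ u ⟧)
         {k e : ℕ} (k<n : k < arity s) (arity-u : arity u ≡ suc e) where

  open Unshift (suc k) e

  private
    a : ℕ
    a = suc k

    arcD : ∀ {p q} → p < q → Inner a (suc e) p q → IsArc (arity u) (suc (p ∸ a)) (suc (q ∸ a))
    arcD {p} {q} p<q (a≤p , q≤) =
      s≤s z≤n , s≤s (∸-monoˡ-< p<q a≤p) ,
      s≤s (subst (q ∸ a ≤_) (trans (m+n∸m≡n a (suc e)) (sym arity-u)) (∸-monoˡ-≤ a q≤))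

    back : ∀ {v} → a ≤ v → suc (v ∸ a) + k ≡ v
    back {v} a≤v = trans (sym (+-suc (v ∸ a) k)) (m∸n+n≡m a≤v)

  inner-colour : ∀ {p q} → p < q → Inner a (suc e) p q →
                 col D (suc (p ∸ a)) (suc (q ∸ a)) ≡ blueIf (blueArc u a p q)
  inner-colour p<q inner@(a≤p , _) = trans (≈⟦⟧-col u D≈ (arcD p<q inner))
    (cong blueIf (trans (sym (blueArc-shift u 1 k _ _))
                        (cong₂ (blueArc u a) (back a≤p) (back (≤-trans a≤p (<⇒≤ p<q))))))

  glued-colour : composedColour (col C) (col D) a (suc e) a (a + suc e) ≡ blueIf (blueArc u a a (a + suc e))
  glued-colour = begin
    composedColour (col C) (col D) a (suc e) a (a + suc e)
      ≡⟨ if-cong (dec-true ((a ≟ a) ×-dec (a + suc e ≟ a + suc e)) (refl , refl)) ⟩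
    glue (col C a (suc a)) (col D 1 (suc (suc e)))
      ≡⟨ cong₂ glue edge-blue base-colour ⟩
    glue blue (blueIf (blueArc u 1 1 (suc (suc e))))
      ≡⟨ glue-blue _ ⟩
    blueIf (blueArc u 1 1 (suc (suc e)))
      ≡⟨ cong blueIf (blueArc-shift u 1 k 1 (suc (suc e))) ⟨
    blueIf (blueArc u a a (suc (suc e) + k))
      ≡⟨ cong (λ x → blueIf (blueArc u a a (suc x))) (+-comm (suc e) k) ⟩
    blueIf (blueArc u a a (a + suc e)) ∎
    where
    open ≡-Reasoning
    base-colour : col D 1 (suc (suc e)) ≡ blueIf (blueArc u 1 1 (suc (suc e)))
    base-colour = ≈⟦⟧-col u D≈ (s≤s z≤n , s≤s (s≤s z≤n) , s≤s (≤-reflexive (sym arity-u)))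
    edge-blue : col C a (suc a) ≡ blue
    edge-blue = trans (≈⟦⟧-col s C≈ (s≤s z≤n , ≤-refl , s≤s k<n))
                      (T⇒blueIf (blueArc-edge s 1 (s≤s z≤n) (s≤s k<n)))

  inner-composedColour : ∀ {p q} → p < q → Inner a (suc e) p q →
                         composedColour (col C) (col D) a (suc e) p q ≡ blueIf (blueArc u a p q)
  inner-composedColour {p} {q} p<q inner with (p ≟ a) ×-dec (q ≟ a + suc e)
  ... | yes (refl , refl) = glued-colour
  ... | no ¬glued = trans (if-cong (dec-false ((p ≟ a) ×-dec (q ≟ a + suc e)) ¬glued))
                      (trans (if-cong (dec-true (inner? a (suc e) p q) inner)) (inner-colour p<q inner))

  outer-composedColour : ∀ {p q} → IsArc (arity s + e) p q → ¬ Inner a (suc e) p q →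
    composedColour (col C) (col D) a (suc e) p q
      ≡ blueIf (does (outer? a (suc e) p ×-dec outer? a (suc e) q) ∧ blueArc s 1 (unshift a (suc e) p) (unshift a (suc e) q))
  outer-composedColour {p} {q} arc ¬inner =
    trans (if-cong (dec-false ((p ≟ a) ×-dec (q ≟ a + suc e))
                              (λ (p≡a , q≡a+m) → ¬inner (≤-reflexive (sym p≡a) , ≤-reflexive q≡a+m))))
    (trans (if-cong (dec-false (inner? a (suc e) p q) ¬inner))
           (if-does-∧ (outer? a (suc e) p ×-dec outer? a (suc e) q)
                      (λ (op , oq) → ≈⟦⟧-col s C≈ (unshift-arc k<n arc op oq))))

  composedColour-blue : ∀ {p q} → IsArc (arity s + e) p q →
    composedColour (col C) (col D) a (suc e) p q ≡ blueIf (graftedBlue (blueArc s 1) (blueArc u a) a (suc e) p q)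
  composedColour-blue {p} {q} arc@(_ , p<q , _) with inner? a (suc e) p q
  ... | yes inner = trans (inner-composedColour p<q inner)
                          (cong blueIf (sym (if-cong (dec-true (inner? a (suc e) p q) inner))))
  ... | no ¬inner = trans (outer-composedColour arc ¬inner)
                          (cong blueIf (sym (if-cong (dec-false (inner? a (suc e) p q) ¬inner))))

∘⟨⟩-≈⟦⟧ : ∀ {C D} s u {k} → k < arity s → C ≈ ⟦ s ⟧ → D ≈ ⟦ u ⟧ →
          (C ∘⟨ suc k ⟩ D) ≈ ⟦ graft s k u ⟧
∘⟨⟩-≈⟦⟧ {C} {D} s u {k} k<n C≈ D≈ with e , arity-u ← arity-suc u =
  trans size≡ (sym arity-≡) , colour≡
  where
  open ≡-Reasoning
  size-D : size D ≡ suc e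
  size-D = trans (proj₁ D≈) arity-u
  size≡ : size C + size D ∸ 1 ≡ arity s + e
  size≡ = trans (cong₂ (λ x y → x + y ∸ 1) (proj₁ C≈) size-D) (cong (_∸ 1) (+-suc (arity s) e))
  arity-≡ : arity (graft s k u) ≡ arity s + e
  arity-≡ = arity-graft s k u arity-u k<n
  colour≡ : ∀ p q → IsArc (size C + size D ∸ 1) p q →
            col (C ∘⟨ suc k ⟩ D) p q ≡ blueIf (blueArc (graft s k u) 1 p q)
  colour≡ p q arc = begin
    col (C ∘⟨ suc k ⟩ D) p q
      ≡⟨ col-∘⟨⟩ C (suc k) D p q ⟩
    composedColour (col C) (col D) (suc k) (size D) p q
      ≡⟨ cong (λ m → composedColour (col C) (col D) (suc k) m p q) size-D ⟩
    composedColour (col C) (col D) (suc k) (suc e) p q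
      ≡⟨ composedColour-blue {s} {u} C≈ D≈ k<n arity-u (subst (λ n → IsArc n p q) size≡ arc) ⟩
    blueIf (graftedBlue (blueArc s 1) (blueArc u (suc k)) (suc k) (suc e) p q)
      ≡⟨ cong (λ m → blueIf (graftedBlue (blueArc s 1) (blueArc u (suc k)) (suc k) m p q)) arity-u ⟨
    blueIf (graftedBlue (blueArc s 1) (blueArc u (suc k)) (suc k) (arity u) p q)
      ≡⟨ cong blueIf (blueArc-graft s k u 1 k<n p q) ⟨
    blueIf (blueArc (graft s k u) 1 p q) ∎

unit≈⟦leaf⟧ : unitC ≈ ⟦ leaf ⟧
unit≈⟦leaf⟧ = refl , arcs
  where
  arcs : ∀ p q → IsArc 1 p q → blue ≡ blueIf (blueArc leaf 1 p q)
  arcs 1 2 _ = refl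
  arcs 0 _ (() , _)
  arcs 1 0 (_ , () , _)
  arcs 1 1 (_ , s≤s () , _)
  arcs 1 (suc (suc (suc _))) (_ , _ , s≤s (s≤s ()))
  arcs (suc (suc p)) q (_ , p<q , q≤2) = contradiction (<-≤-trans p<q q≤2) λ { (s≤s (s≤s ())) }

triangle-arcs : ∀ g p q → IsArc 2 p q → col (πG g) p q ≡ blueIf (blueArc (gen g) 1 p q)
triangle-arcs α 1 2 _ = refl
triangle-arcs α 1 3 _ = refl
triangle-arcs α 2 3 _ = refl
triangle-arcs β 1 2 _ = refl
triangle-arcs β 1 3 _ = refl
triangle-arcs β 2 3 _ = refl
triangle-arcs _ 0 _ (() , _)
triangle-arcs _ 1 0 (_ , () , _)
triangle-arcs _ 1 1 (_ , s≤s () , _)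
triangle-arcs _ 1 (suc (suc (suc (suc _)))) (_ , _ , s≤s (s≤s (s≤s ())))
triangle-arcs _ 2 0 (_ , () , _)
triangle-arcs _ 2 1 (_ , s≤s () , _)
triangle-arcs _ 2 2 (_ , s≤s (s≤s ()) , _)
triangle-arcs _ 2 (suc (suc (suc (suc _)))) (_ , _ , s≤s (s≤s (s≤s ())))
triangle-arcs _ (suc (suc (suc p))) q (_ , p<q , q≤3) =
  contradiction (<-≤-trans p<q q≤3) λ { (s≤s (s≤s (s≤s ()))) }

πG≈⟦gen⟧ : ∀ g → πG g ≈ ⟦ gen g ⟧
πG≈⟦gen⟧ α = refl , triangle-arcs α
πG≈⟦gen⟧ β = refl , triangle-arcs β

π≈⟦⟧ : ∀ t → π t ≈ ⟦ t ⟧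
π≈⟦⟧ leaf         = unit≈⟦leaf⟧
π≈⟦⟧ (node g l r) =
  ∘⟨⟩-≈⟦⟧ (node g leaf r) l (s≤s z≤n)
    (∘⟨⟩-≈⟦⟧ (gen g) r (s≤s (s≤s z≤n)) (πG≈⟦gen⟧ g) (π≈⟦⟧ r)) (π≈⟦⟧ l)

π-generated : ∀ t → Gen⟨⟩ (π t)
π-generated leaf         = g-unit
π-generated (node α l r) =
  g-comp 1 (s≤s z≤n) (s≤s z≤n) (g-comp 2 (s≤s z≤n) ≤-refl g-aaa (π-generated r)) (π-generated l)
π-generated (node β l r) =
  g-comp 1 (s≤s z≤n) (s≤s z≤n) (g-comp 2 (s≤s z≤n) ≤-refl g-aba (π-generated r)) (π-generated l)

generated⇒≈⟦⟧ : ∀ {D} → Gen⟨⟩ D → Σ Tree (λ t → D ≈ ⟦ t ⟧)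
generated⇒≈⟦⟧ g-unit = leaf , unit≈⟦leaf⟧
generated⇒≈⟦⟧ g-aaa  = gen α , πG≈⟦gen⟧ α
generated⇒≈⟦⟧ g-aba  = gen β , πG≈⟦gen⟧ β
generated⇒≈⟦⟧ (g-comp (suc k) _ k<n genC genD)
  with s , C≈ ← generated⇒≈⟦⟧ genC | u , D≈ ← generated⇒≈⟦⟧ genD
  = graft s k u , ∘⟨⟩-≈⟦⟧ s u (subst (k <_) (proj₁ C≈) k<n) C≈ D≈


-- The defining relations preserve blue arcs

record SameBlueArcs (s t : Tree) : Set where
  constructor sameBlueArcs
  field
    arity≡   : arity s ≡ arity t
    blueArc≡ : ∀ o p q → blueArc s o p q ≡ blueArc t o p q

blueArc-rotate : ∀ g a b c o p q → blueArc (node g (node β a b) c) o p q ≡ blueArc (node g a (node β b c)) o p q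
blueArc-rotate g a b c o p q = cong₂ _∨_
  (cong (λ n → arcIf (isα g) o (o + n) p q) (+-assoc (arity a) (arity b) (arity c)))
  (trans (∨-assoc (blueArc a o p q) _ _)
         (cong (λ x → blueArc a o p q ∨ blueArc b (o + arity a) p q ∨ blueArc c x p q)
               (sym (+-assoc o (arity a) (arity b)))))

graft-sameBlueArcs : ∀ {s s' u u'} k → k < arity s → SameBlueArcs s s' → SameBlueArcs u u' →
                     SameBlueArcs (graft s k u) (graft s' k u')
graft-sameBlueArcs {s} {s'} {u} {u'} k k<n (sameBlueArcs arity-s same-s) (sameBlueArcs arity-u same-u)
  with e , arity-u≡ ← arity-suc u = sameBlueArcs
    (trans (arity-graft s k u arity-u≡ k<n)
          (trans (cong (_+ e) arity-s) (sym (arity-graft s' k u' (trans (sym arity-u) arity-u≡) k<n'))))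
    λ o p q → begin
      blueArc (graft s k u) o p q
        ≡⟨ blueArc-graft s k u o k<n p q ⟩
      graftedBlue (blueArc s o) (blueArc u (o + k)) (o + k) (arity u) p q
        ≡⟨ cong (λ m → graftedBlue (blueArc s o) (blueArc u (o + k)) (o + k) m p q) arity-u ⟩
      graftedBlue (blueArc s o) (blueArc u (o + k)) (o + k) (arity u') p q
        ≡⟨ graftedBlue-cong (o + k) (arity u') p q (same-s o) (same-u (o + k)) ⟩
      graftedBlue (blueArc s' o) (blueArc u' (o + k)) (o + k) (arity u') p q
        ≡⟨ blueArc-graft s' k u' o k<n' p q ⟨
      blueArc (graft s' k u') o p q ∎
  where
  open ≡-Reasoning
  k<n' : k < arity s'
  k<n' = subst (k <_) arity-s k<n

sameBlueArcs-refl : ∀ {t} → SameBlueArcs t t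
sameBlueArcs-refl = sameBlueArcs refl λ _ _ _ → refl

≡F⇒sameBlueArcs : ∀ {s t} → s ≡F t → SameBlueArcs s t
≡F⇒sameBlueArcs rel-ββ = sameBlueArcs refl (blueArc-rotate β leaf leaf leaf)
≡F⇒sameBlueArcs rel-αβ = sameBlueArcs refl (blueArc-rotate α leaf leaf leaf)
≡F⇒sameBlueArcs ≡F-refl = sameBlueArcs-refl
≡F⇒sameBlueArcs (≡F-sym s≡t) with sameBlueArcs arity≡ same ← ≡F⇒sameBlueArcs s≡t =
  sameBlueArcs (sym arity≡) λ o p q → sym (same o p q)
≡F⇒sameBlueArcs (≡F-trans s≡t t≡u)
  with sameBlueArcs arity≡ same ← ≡F⇒sameBlueArcs s≡t | sameBlueArcs arity≡' same' ← ≡F⇒sameBlueArcs t≡u =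
  sameBlueArcs (trans arity≡ arity≡') λ o p q → trans (same o p q) (same' o p q)
≡F⇒sameBlueArcs (≡F-congˡ u (suc k) _ k<n s≡t) =
  graft-sameBlueArcs k k<n (≡F⇒sameBlueArcs s≡t) sameBlueArcs-refl
≡F⇒sameBlueArcs (≡F-congʳ u (suc k) _ k<n s≡t) =
  graft-sameBlueArcs k k<n (sameBlueArcs-refl {u}) (≡F⇒sameBlueArcs s≡t)

sameBlueArcs⇒⟦⟧≈ : ∀ {s t} → SameBlueArcs s t → ⟦ s ⟧ ≈ ⟦ t ⟧
sameBlueArcs⇒⟦⟧≈ (sameBlueArcs arity≡ same) = arity≡ , λ p q _ → cong blueIf (same 1 p q)


-- Normal forms

node-congˡ : ∀ g {l l'} r → l ≡F l' → node g l r ≡F node g l' r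
node-congˡ g r = ≡F-congʳ (node g leaf r) 1 (s≤s z≤n) (s≤s z≤n)

node-congʳ : ∀ g l {r r'} → r ≡F r' → node g l r ≡F node g l r'
node-congʳ g l {r} {r'} r≡r' =
  subst₂ _≡F_ (graft-last r) (graft-last r')
         (≡F-congʳ (node g l leaf) (suc (arity l)) (s≤s z≤n) (≤-reflexive (+-comm 1 (arity l))) r≡r')
  where
  graft-last : ∀ t → graft (node g l leaf) (arity l) t ≡ node g l t
  graft-last t = trans (graft-node-≥ g l leaf t ≤-refl) (cong (λ k → node g l (graft leaf k t)) (n∸n≡0 (arity l)))

rotate-≡F : ∀ g a b c → node g (node β a b) c ≡F node g a (node β b c)
rotate-≡F g a b c =
  ≡F-congˡ a 1 (s≤s z≤n) (s≤s z≤n)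
    (≡F-congˡ b 2 (s≤s z≤n) (s≤s (s≤s z≤n))
      (≡F-congˡ c 3 (s≤s z≤n) ≤-refl (generator g)))
  where
  generator : ∀ g → node g (node β leaf leaf) leaf ≡F node g leaf (node β leaf leaf)
  generator α = rel-αβ
  generator β = rel-ββ

data Normal : Tree → Set where
  leaf      : Normal leaf
  node-leaf : ∀ {g r} → Normal r → Normal (node g leaf r)
  node-α    : ∀ {g a b r} → Normal (node α a b) → Normal r → Normal (node g (node α a b) r)

attach : G → Tree → Tree → Tree
attach g leaf         r = node g leaf r
attach g (node α a b) r = node g (node α a b) r
attach g (node β a b) r = node g a (attach β b r)

normalise : Tree → Tree
normalise leaf         = leaf
normalise (node g l r) = attach g (normalise l) (normalise r)

attach-normal : ∀ g {l r} → Normal l → Normal r → Normal (attach g l r)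
attach-normal g leaf                      nr = node-leaf nr
attach-normal g (node-leaf {g = α} nb)    nr = node-α (node-leaf nb) nr
attach-normal g (node-leaf {g = β} nb)    nr = node-leaf (attach-normal β nb nr)
attach-normal g (node-α {g = α} na nb)    nr = node-α (node-α na nb) nr
attach-normal g (node-α {g = β} na nb)    nr = node-α na (attach-normal β nb nr)

attach-≡F : ∀ g l r → attach g l r ≡F node g l r
attach-≡F g leaf         r = ≡F-refl
attach-≡F g (node α a b) r = ≡F-refl
attach-≡F g (node β a b) r = ≡F-trans (node-congʳ g a (attach-≡F β b r)) (≡F-sym (rotate-≡F g a b r))

normalise-normal : ∀ t → Normal (normalise t)
normalise-normal leaf         = leaf
normalise-normal (node g l r) = attach-normal g (normalise-normal l) (normalise-normal r)

normalise-≡F : ∀ t → normalise t ≡F t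
normalise-≡F leaf         = ≡F-refl
normalise-≡F (node g l r) =
  ≡F-trans (attach-≡F g (normalise l) (normalise r))
           (≡F-trans (node-congˡ g (normalise r) (normalise-≡F l)) (node-congʳ g l (normalise-≡F r)))

isα-injective : ∀ {g g'} → isα g ≡ isα g' → g ≡ g'
isα-injective {α} {α} _ = refl
isα-injective {β} {β} _ = refl

normal-leftSpan : ∀ {g l r} o → Normal (node g l r) → T (blueArc l o o (o + arity l))
normal-leftSpan o (node-leaf _) =
  subst (λ x → T (blueArc leaf o o x)) (+-comm 1 o) (blueArc-edge leaf o ≤-refl (m<m+n o (s≤s z≤n)))
normal-leftSpan o (node-α {a = a} {b} _ _) = subst T (sym (blueArc-node-span α a b o)) _

blueArc-beyond-leftSpan : ∀ g l r o {k} → arity l < k → k < arity (node g l r) →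
                          blueArc (node g l r) o o (o + k) ≡ false
blueArc-beyond-leftSpan g l r o {k} l<k k<n = cong₂ _∨_
  (arcIf-false (isα g) o (o + arity (node g l r)) {o} {o + k} λ _ eq → <⇒≢ k<n (+-cancelˡ-≡ o k _ eq))
  (cong₂ _∨_ (blueArc-after l o (+-monoʳ-< o l<k)) (blueArc-before r (o + k) (m<m+n o (arity-pos l))))

normal-left : ∀ {g l r} → Normal (node g l r) → Normal l
normal-left (node-leaf _)  = leaf
normal-left (node-α nl _)  = nl

normal-right : ∀ {g l r} → Normal (node g l r) → Normal r
normal-right (node-leaf nr) = nr
normal-right (node-α _ nr)  = nr

record SameArcsAt (o : ℕ) (s t : Tree) : Set where
  constructor sameArcsAt
  field sameArc : ∀ p q → blueArc s o p q ≡ blueArc t o p q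
open SameArcsAt

sameArcsAt-sym : ∀ {o s t} → SameArcsAt o s t → SameArcsAt o t s
sameArcsAt-sym same = sameArcsAt λ p q → sym (sameArc same p q)

1≢arity-node : ∀ g l r → 1 ≢ arity (node g l r)
1≢arity-node g l r = <⇒≢ (+-mono-≤ (arity-pos l) (arity-pos r))

module _ {g g' l l' r r' o} (arity≡ : arity (node g l r) ≡ arity (node g' l' r'))
         (same : SameArcsAt o (node g l r) (node g' l' r')) where

  leftSpan-≮ : Normal (node g' l' r') → ¬ arity l < arity l'
  leftSpan-≮ nt l<l' =
    subst T (trans (sym (sameArc same o (o + arity l'))) (blueArc-beyond-leftSpan g l r o l<l' l'<n))
            (subst T (sym (blueArc-node-left g' l' r' o ≤-refl)) (normal-leftSpan o nt))
    where
    l'<n : arity l' < arity (node g l r)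
    l'<n = subst (arity l' <_) (sym arity≡) (m<m+n (arity l') (arity-pos r'))

  root-label≡ : g ≡ g'
  root-label≡ = isα-injective (begin
    isα g                                                   ≡⟨ blueArc-node-span g l r o ⟨
    blueArc (node g l r) o o (o + arity (node g l r))       ≡⟨ sameArc same o _ ⟩
    blueArc (node g' l' r') o o (o + arity (node g l r))    ≡⟨ cong (λ n → blueArc (node g' l' r') o o (o + n)) arity≡ ⟩
    blueArc (node g' l' r') o o (o + arity (node g' l' r')) ≡⟨ blueArc-node-span g' l' r' o ⟩
    isα g'                                                  ∎)
    where open ≡-Reasoning

  left-sameArcs : arity l ≡ arity l' → SameArcsAt o l l'
  left-sameArcs l≡l' = sameArcsAt λ p q → leftArc p q
    where
    leftArc : ∀ p q → blueArc l o p q ≡ blueArc l' o p q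
    leftArc p q with q ≤? o + arity l
    ... | yes q≤mid = trans (sym (blueArc-node-left g l r o q≤mid))
                     (trans (sameArc same p q) (blueArc-node-left g' l' r' o (subst (λ n → q ≤ o + n) l≡l' q≤mid)))
    ... | no q≰mid = trans (blueArc-after l p (≰⇒> q≰mid))
                           (sym (blueArc-after l' p (subst (λ n → o + n < q) l≡l' (≰⇒> q≰mid))))

  right-sameArcs : l ≡ l' → SameArcsAt (o + arity l) r r'
  right-sameArcs refl = sameArcsAt λ p q → rightArc p q
    where
    rightArc : ∀ p q → blueArc r (o + arity l) p q ≡ blueArc r' (o + arity l) p q
    rightArc p q with o + arity l ≤? p
    ... | yes mid≤p = trans (sym (blueArc-node-right g l r o mid≤p))
                            (trans (sameArc same p q) (blueArc-node-right g' l r' o mid≤p))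
    ... | no mid≰p = trans (blueArc-before r q (≰⇒> mid≰p)) (sym (blueArc-before r' q (≰⇒> mid≰p)))

normal-leftArity≡ : ∀ {g g' l l' r r' o} → Normal (node g l r) → Normal (node g' l' r') →
                    arity (node g l r) ≡ arity (node g' l' r') → SameArcsAt o (node g l r) (node g' l' r') →
                    arity l ≡ arity l'
normal-leftArity≡ ns nt arity≡ same = ≤-antisym (≮⇒≥ (leftSpan-≮ (sym arity≡) (sameArcsAt-sym same) ns))
                                                (≮⇒≥ (leftSpan-≮ arity≡ same nt))

normal-injective : ∀ o {s t} → Normal s → Normal t → arity s ≡ arity t → SameArcsAt o s t → s ≡ t
normal-injective o {leaf}       {leaf}          _  _  _      _ = refl
normal-injective o {leaf}       {node g' l' r'} _  _  arity≡ _ = contradiction arity≡ (1≢arity-node g' l' r')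
normal-injective o {node g l r} {leaf}          _  _  arity≡ _ = contradiction (sym arity≡) (1≢arity-node g l r)
normal-injective o {node g l r} {node g' l' r'} ns nt arity≡ same
  with l≡l' ← normal-leftArity≡ ns nt arity≡ same
  with refl ← root-label≡ arity≡ same
     | refl ← normal-injective o (normal-left ns) (normal-left nt) l≡l' (left-sameArcs arity≡ same l≡l')
  = cong (node g l) (normal-injective (o + arity l) (normal-right ns) (normal-right nt)
                       (+-cancelˡ-≡ (arity l) _ _ arity≡) (right-sameArcs arity≡ same refl))

blueIf-injective : ∀ {b b'} → blueIf b ≡ blueIf b' → b ≡ b'
blueIf-injective {true}  {true}  _ = refl
blueIf-injective {false} {false} _ = refl

within? : ∀ o n p q → Dec (Within o n p q)
within? o n p q = o ≤? p ×-dec p <? q ×-dec q ≤? o + n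

⟦⟧≈⇒sameArcsAt1 : ∀ {s t} → ⟦ s ⟧ ≈ ⟦ t ⟧ → SameArcsAt 1 s t
⟦⟧≈⇒sameArcsAt1 {s} {t} (arity≡ , same) = sameArcsAt arc
  where
  arc : ∀ p q → blueArc s 1 p q ≡ blueArc t 1 p q
  arc p q with within? 1 (arity s) p q
  ... | yes isArc = blueIf-injective (same p q isArc)
  ... | no ¬isArc = trans (blueArc-outside s 1 ¬isArc)
                      (sym (blueArc-outside t 1 (¬isArc ∘ subst (λ n → Within 1 n p q) (sym arity≡))))

⟦⟧≈⇒≡F : ∀ s t → ⟦ s ⟧ ≈ ⟦ t ⟧ → s ≡F t
⟦⟧≈⇒≡F s t ⟦s⟧≈⟦t⟧ =
  ≡F-trans (≡F-sym (normalise-≡F s)) (subst (_≡F t) (sym normalForms≡) (normalise-≡F t))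
  where
  ⟦normalise⟧≈ : ∀ t → ⟦ normalise t ⟧ ≈ ⟦ t ⟧
  ⟦normalise⟧≈ t = sameBlueArcs⇒⟦⟧≈ (≡F⇒sameBlueArcs (normalise-≡F t))
  normalForms≈ : ⟦ normalise s ⟧ ≈ ⟦ normalise t ⟧
  normalForms≈ = ≈-trans (⟦normalise⟧≈ s) (≈-trans ⟦s⟧≈⟦t⟧ (≈-sym (⟦normalise⟧≈ t)))
  normalForms≡ : normalise s ≡ normalise t
  normalForms≡ = normal-injective 1 (normalise-normal s) (normalise-normal t)
                   (proj₁ normalForms≈) (⟦⟧≈⇒sameArcsAt1 normalForms≈)


mainTheorem17 : (∀ s t → (π s ≈ π t) ⇔ (s ≡F t))
    × (∀ C → (C ∈⟨τaaa,τaba⟩) ⇔ Σ Tree (λ t → π t ≈ C))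
mainTheorem17 = kernel , image
  where
  kernel : ∀ s t → (π s ≈ π t) ⇔ (s ≡F t)
  kernel s t = mk⇔
    (λ πs≈πt → ⟦⟧≈⇒≡F s t (≈-trans (≈-sym (π≈⟦⟧ s)) (≈-trans πs≈πt (π≈⟦⟧ t))))
    (λ s≡t → ≈-trans (π≈⟦⟧ s)
               (≈-trans (sameBlueArcs⇒⟦⟧≈ (≡F⇒sameBlueArcs s≡t)) (≈-sym (π≈⟦⟧ t))))
  image : ∀ C → (C ∈⟨τaaa,τaba⟩) ⇔ Σ Tree (λ t → π t ≈ C)
  image C = mk⇔
    (λ (D , genD , C≈D) → let (t , D≈) = generated⇒≈⟦⟧ genD in
                           t , ≈-trans (π≈⟦⟧ t) (≈-sym (≈-trans C≈D D≈)))
    (λ (t , πt≈C) → π t , π-generated t , ≈-sym πt≈C)
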